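{- For the infinite king grid KNG, $\mathrm{DET{:}OLD\%}(\mathrm{KNG}) \le \frac{13}{30}$; that is, there is a DET:OLD set of KNG of density at most $\frac{13}{30}$.
   Context: The infinite king grid KNG has vertex set $\mathbb{Z}^2$, with distinct vertices $(x,y),(x',y')$ adjacent iff $\max(|x-x'|,|y-y'|)=1$. For a graph $G$ and $v\in V(G)$, $N(v)$ is the open neighborhood of $v$; for $S\subseteq V(G)$ write $N_S(v)=N(v)\cap S$. A set $S\subseteq V(G)$ is a DET:OLD set of $G$ if (1) every vertex $v$ satisfies $|N_S(v)|\ge 2$, and (2) every pair of distinct vertices $u,v$ satisfies $|N_S(u)\setminus N_S(v)|\ge 2$ or $|N_S(v)\setminus N_S(u)|\ge 2$. The density of $S\subseteq\mathbb{Z}^2$ is $\limsup_{r\to\infty}|S\cap B_r|/|B_r|$ where $B_r=\{(x,y):|x|,|y|\le r\}$, and $\mathrm{DET{:}OLD\%}(\mathrm{KNG})$ is the infimum of the densities of DET:OLD sets of KNG. -}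

module Defs where

open import Data.Bool using (Bool; true; false; _∧_; _∨_; not; if_then_else_)
open import Data.Nat as ℕ using (ℕ; _⊔_; _≡ᵇ_; _≤_)
open import Data.Integer as ℤ using (ℤ; +_; ∣_∣)
open import Data.Product using (_×_; _,_; Σ-syntax; ∃-syntax)
open import Data.List using (List; []; _∷_; map; filter; length; concatMap; upTo; sum)
open import Data.Bool using (T)
open import Relation.Nullary.Decidable using (T?)
open import Relation.Binary.PropositionalEquality using (_≡_)
open import Relation.Nullary using (¬_)

Pt : Set
Pt = ℤ × ℤ

-- Adjacency in KNG: max(|x-x'|,|y-y'|) = 1 (this forces distinctness)
adj : Pt → Pt → Bool
adj (x , y) (x' , y') = (∣ x ℤ.- x' ∣ ⊔ ∣ y ℤ.- y' ∣) ≡ᵇ 1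

Subset : Set
Subset = Pt → Bool

unitRange : List ℤ
unitRange = ℤ.-[1+ 0 ] ∷ + 0 ∷ + 1 ∷ []

box3 : Pt → List Pt
box3 (x , y) = concatMap (λ i → map (λ j → (x ℤ.+ i , y ℤ.+ j)) unitRange) unitRange

-- open neighbourhood N(v) (all neighbours of v lie in box3 v)
N : Pt → List Pt
N v = filter (λ w → T? (adj v w)) (box3 v)

N[_] : Subset → Pt → List Pt
N[ S ] v = filter (λ w → T? (S w)) (N v)

diffCount : Subset → Pt → Pt → ℕ
diffCount S u v = length (filter (λ w → T? (not (S w ∧ adj v w))) (N[ S ] u))

IsDetOLD : Subset → Set
IsDetOLD S =
  (∀ v → 2 ≤ length (N[ S ] v)) ×
  (∀ u v → ¬ (u ≡ v) → (2 ≤ diffCount S u v) Data.Sum.⊎ (2 ≤ diffCount S v u))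
  where import Data.Sum

range : ℕ → List ℤ
range r = map (λ i → + i ℤ.- + r) (upTo (2 ℕ.* r ℕ.+ 1))

ball : ℕ → List Pt
ball r = concatMap (λ x → map (λ y → (x , y)) (range r)) (range r)

countIn : Subset → ℕ → ℕ
countIn S r = length (filter (λ p → T? (S p)) (ball r))

ballSize : ℕ → ℕ
ballSize r = (2 ℕ.* r ℕ.+ 1) ℕ.* (2 ℕ.* r ℕ.+ 1)

-- density(S) = limsup_r |S ∩ B_r| / |B_r| ≤ p / q  (q > 0), unfolded:
-- for every ε = 1/(k+1) > 0, eventually |S ∩ B_r| / |B_r| ≤ p/q + 1/(k+1),
-- i.e. q(k+1)|S ∩ B_r| ≤ (p(k+1) + q)|B_r|.
DensityAtMost : Subset → ℕ → ℕ → Set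
DensityAtMost S p q =
  ∀ (k : ℕ) → ∃[ R ] ∀ (r : ℕ) → R ≤ r →
    q ℕ.* ℕ.suc k ℕ.* countIn S r ≤ (p ℕ.* ℕ.suc k ℕ.+ q) ℕ.* ballSize r

module Submission where

-- The witness is the set of points (x , y) with y + 19x mod 30 in a fixed set of 13
-- residues. It is invariant under the translations (a , b) with b + 19a ≡ 0 (mod 30),
-- among them (0 , 30), so each row contains at most 13 of its points in any 30
-- consecutive columns, which gives density 13/30. Vertices at Chebyshev distance at
-- least 3 have disjoint neighbourhoods, so the DET:OLD conditions only involve
-- displacements in the 5×5 box around a vertex; by translation invariance they depend
-- only on the residue of the vertex, and the 30 cases are checked by evaluation.

open import Defs
open import Data.Bool using (Bool; true; false; _∧_; not; T; if_then_else_)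
open import Data.Nat as ℕ using (ℕ; zero; suc; _+_; _*_; _≤_; _<_; _≤?_; _<?_; _⊔_; _≡ᵇ_; z≤n; NonZero)
import Data.Nat.Properties as ℕₚ
import Data.Nat.Divisibility as ℕ-Div
import Data.Nat.DivMod as ℕ-DivMod
open import Data.Nat.Induction using (<-wellFounded)
import Data.Nat.Tactic.RingSolver as ℕ-Ring
open import Data.Integer as ℤ using (ℤ; +_; -[1+_]; 0ℤ; ∣_∣; _%ℕ_; _/ℕ_)
import Data.Integer.Properties as ℤₚ
open import Data.Integer.DivMod using (a≡a%ℕn+[a/ℕn]*n; n%ℕd<d)
open import Data.Integer.Divisibility.Signed using (divides; ∣⇒∣ᵤ)
import Data.Integer.Tactic.RingSolver as ℤ-Ring
open import Data.List using (List; []; _∷_; _++_; map; filter; length; concatMap; applyUpTo; upTo)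
open import Data.List.Properties using (length-map; length-++; filter-++; filter-all; map-cong; map-∘; length-upTo)
open import Data.List.Relation.Unary.All as All using (All)
open import Data.List.Relation.Unary.All.Properties using (all-filter; filter⁺)
open import Data.List.Membership.Propositional using (_∈_)
open import Data.List.Membership.Propositional.Properties using (∈-map⁺; ∈-concat⁺′; ∈-upTo⁺)
open import Data.List.Membership.DecPropositional ℕ._≟_ using (_∈?_)
open import Data.Product using (Σ-syntax; _×_; _,_; proj₁; proj₂)
import Data.Product as Product
open import Data.Product.Properties using (≡-dec)
open import Data.Sum using (_⊎_; inj₁; inj₂)
import Data.Sum as Sum
open import Data.Unit using (tt)
open import Data.Empty using (⊥-elim)
open import Function using (_∘_)
open import Induction.WellFounded using (Acc; acc)
open import Relation.Nullary using (Dec; does; yes; no; ¬_)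
open import Relation.Nullary.Decidable using (T?; _×-dec_; _⊎-dec_; from-yes)
open import Relation.Binary.Definitions using (DecidableEquality)
open import Relation.Binary.PropositionalEquality

filterᵇ : {A : Set} → (A → Bool) → List A → List A
filterᵇ f = filter (λ x → T? (f x))

count : {A : Set} → (A → Bool) → List A → ℕ
count f xs = length (filterᵇ f xs)

module _ {A : Set} where

  filterᵇ-cong : {f g : A → Bool} → f ≗ g → filterᵇ f ≗ filterᵇ g
  filterᵇ-cong f≗g [] = refl
  filterᵇ-cong {f} {g} f≗g (x ∷ xs) with f x | g x | f≗g x
  ... | true  | true  | refl = cong (x ∷_) (filterᵇ-cong f≗g xs)
  ... | false | false | refl = filterᵇ-cong f≗g xs

  filterᵇ-map : {B : Set} (f : B → Bool) (g : A → B) (xs : List A) →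
                filterᵇ f (map g xs) ≡ map g (filterᵇ (f ∘ g) xs)
  filterᵇ-map f g [] = refl
  filterᵇ-map f g (x ∷ xs) with f (g x)
  ... | true  = cong (g x ∷_) (filterᵇ-map f g xs)
  ... | false = filterᵇ-map f g xs

  count-cong : {f g : A → Bool} → f ≗ g → count f ≗ count g
  count-cong f≗g xs = cong length (filterᵇ-cong f≗g xs)

  count-map : {B : Set} (f : B → Bool) (g : A → B) (xs : List A) →
              count f (map g xs) ≡ count (f ∘ g) xs
  count-map f g xs = trans (cong length (filterᵇ-map f g xs)) (length-map g (filterᵇ (f ∘ g) xs))

  count-++ : (f : A → Bool) (xs ys : List A) → count f (xs ++ ys) ≡ count f xs + count f ys
  count-++ f xs ys = trans (cong length (filter-++ (λ x → T? (f x)) xs ys)) (length-++ (filterᵇ f xs))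

count-concatMap-≤ : {A B : Set} {k n : ℕ} (f : B → Bool) (g : A → List B) (xs : List A) →
                    (∀ x → k * count f (g x) ≤ n) →
                    k * count f (concatMap g xs) ≤ length xs * n
count-concatMap-≤ {k = k} f g [] bound = ℕₚ.≤-reflexive (ℕₚ.*-zeroʳ k)
count-concatMap-≤ {k = k} {n} f g (x ∷ xs) bound = begin
  k * count f (g x ++ concatMap g xs)
    ≡⟨ cong (k *_) (count-++ f (g x) (concatMap g xs)) ⟩
  k * (count f (g x) + count f (concatMap g xs))
    ≡⟨ ℕₚ.*-distribˡ-+ k _ _ ⟩
  k * count f (g x) + k * count f (concatMap g xs)
    ≤⟨ ℕₚ.+-mono-≤ (bound x) (count-concatMap-≤ {k = k} f g xs bound) ⟩
  n + length xs * n
    ∎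
  where open ℕₚ.≤-Reasoning

indicator : Bool → ℕ
indicator b = if b then 1 else 0

countBelow : (ℕ → Bool) → ℕ → ℕ
countBelow f zero    = 0
countBelow f (suc n) = indicator (f 0) + countBelow (f ∘ suc) n

count-applyUpTo : {A : Set} (f : A → Bool) (g : ℕ → A) (n : ℕ) →
                  count f (applyUpTo g n) ≡ countBelow (f ∘ g) n
count-applyUpTo f g zero = refl
count-applyUpTo f g (suc n) with f (g 0)
... | true  = cong suc (count-applyUpTo f (g ∘ suc) n)
... | false = count-applyUpTo f (g ∘ suc) n

countBelow-cong : {f g : ℕ → Bool} → f ≗ g → countBelow f ≗ countBelow g
countBelow-cong f≗g zero    = refl
countBelow-cong f≗g (suc n) = cong₂ _+_ (cong indicator (f≗g 0)) (countBelow-cong (f≗g ∘ suc) n)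

countBelow-+ : ∀ f m n → countBelow f (m + n) ≡ countBelow f m + countBelow (λ k → f (m + k)) n
countBelow-+ f zero    n = refl
countBelow-+ f (suc m) n = trans (cong (_+_ (indicator (f 0))) (countBelow-+ (f ∘ suc) m n))
                                 (sym (ℕₚ.+-assoc (indicator (f 0)) (countBelow (f ∘ suc) m) _))

countBelow-periodic-≤ : ∀ {p b c} .{{_ : NonZero p}} (f : ℕ → Bool) →
                        (∀ k → f (p + k) ≡ f k) → countBelow f p ≡ b →
                        (∀ {L} → L < p → p * countBelow f L ≤ b * (L + c)) →
                        ∀ L → p * countBelow f L ≤ b * (L + c)
countBelow-periodic-≤ {p} {b} {c} f periodic period short L = go L (<-wellFounded L)
  where
  open ℕₚ.≤-Reasoning

  go : ∀ L → Acc _<_ L → p * countBelow f L ≤ b * (L + c)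
  go L (acc rec) with L <? p
  ... | yes L<p = short L<p
  ... | no L≮p with L′ , refl ← ℕₚ.m≤n⇒∃[o]m+o≡n (ℕₚ.≮⇒≥ L≮p) = begin
    p * countBelow f (p + L′)    ≡⟨ cong (p *_) split ⟩
    p * (b + countBelow f L′)    ≡⟨ ℕₚ.*-distribˡ-+ p b _ ⟩
    p * b + p * countBelow f L′  ≤⟨ ℕₚ.+-monoʳ-≤ (p * b) (go L′ (rec L′<L)) ⟩
    p * b + b * (L′ + c)         ≡⟨ regroup p b L′ c ⟩
    b * (p + L′ + c)             ∎
    where
    split : countBelow f (p + L′) ≡ b + countBelow f L′
    split = trans (countBelow-+ f p L′) (cong₂ _+_ period (countBelow-cong periodic L′))
    L′<L : L′ < p + L′
    L′<L = ℕₚ.m<n+m L′ (ℕ.>-nonZero⁻¹ p)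
    regroup : ∀ p b L c → p * b + b * (L + c) ≡ b * (p + L + c)
    regroup = ℕ-Ring.solve-∀

-- r and the remainder r′ differ by a multiple of d, but by less than d.
%ℕ-unique : ∀ {d r} .{{_ : NonZero d}} q → r < d → (+ r ℤ.+ q ℤ.* + d) %ℕ d ≡ r
%ℕ-unique {d} {r} q r<d = sym (ℤₚ.+-injective (ℤₚ.i-j≡0⇒i≡j (+ r) (+ r′) (ℤₚ.∣i∣≡0⇒i≡0 r-r′≡0)))
  where
  a : ℤ
  a = + r ℤ.+ q ℤ.* + d
  r′ : ℕ
  r′ = a %ℕ d
  d∣r-r′ : d ℕ-Div.∣ ∣ + r ℤ.- + r′ ∣
  d∣r-r′ = ∣⇒∣ᵤ (divides (a /ℕ d ℤ.- q) (begin
    + r ℤ.- + r′                          ≡⟨ regroup (+ r) (+ r′) q (a /ℕ d) (+ d) ⟩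
    (+ r ℤ.+ q ℤ.* + d) ℤ.- (+ r′ ℤ.+ (a /ℕ d) ℤ.* + d) ℤ.+ (a /ℕ d ℤ.- q) ℤ.* + d
      ≡⟨ cong (λ z → a ℤ.- z ℤ.+ (a /ℕ d ℤ.- q) ℤ.* + d) (sym (a≡a%ℕn+[a/ℕn]*n a d)) ⟩
    a ℤ.- a ℤ.+ (a /ℕ d ℤ.- q) ℤ.* + d   ≡⟨ cancel a ((a /ℕ d ℤ.- q) ℤ.* + d) ⟩
    (a /ℕ d ℤ.- q) ℤ.* + d                ∎))
    where
    open ≡-Reasoning
    regroup : ∀ r r′ q q′ d → r ℤ.- r′ ≡ (r ℤ.+ q ℤ.* d) ℤ.- (r′ ℤ.+ q′ ℤ.* d) ℤ.+ (q′ ℤ.- q) ℤ.* d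
    regroup = ℤ-Ring.solve-∀
    cancel : ∀ a b → a ℤ.- a ℤ.+ b ≡ b
    cancel = ℤ-Ring.solve-∀
  small : ∣ + r ℤ.- + r′ ∣ < d
  small = ℕₚ.≤-<-trans (ℕₚ.≤-reflexive (cong ∣_∣ (ℤₚ.[+m]-[+n]≡m⊖n r r′)))
            (ℕₚ.≤-<-trans (ℤₚ.∣m⊝n∣≤m⊔n r r′) (ℕₚ.⊔-lub r<d (n%ℕd<d a d)))
  r-r′≡0 : ∣ + r ℤ.- + r′ ∣ ≡ 0
  r-r′≡0 = trans (sym (ℕ-DivMod.m<n⇒m%n≡m small)) (ℕ-Div.n∣m⇒m%n≡0 _ d d∣r-r′)

%ℕ-periodic : ∀ {d} .{{_ : NonZero d}} i k → (i ℤ.+ k ℤ.* + d) %ℕ d ≡ i %ℕ d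
%ℕ-periodic {d} i k = begin
  (i ℤ.+ k ℤ.* + d) %ℕ d
    ≡⟨ cong (λ j → (j ℤ.+ k ℤ.* + d) %ℕ d) (a≡a%ℕn+[a/ℕn]*n i d) ⟩
  (+ (i %ℕ d) ℤ.+ (i /ℕ d) ℤ.* + d ℤ.+ k ℤ.* + d) %ℕ d
    ≡⟨ cong (_%ℕ d) (regroup (+ (i %ℕ d)) (i /ℕ d) k (+ d)) ⟩
  (+ (i %ℕ d) ℤ.+ (i /ℕ d ℤ.+ k) ℤ.* + d) %ℕ d
    ≡⟨ %ℕ-unique (i /ℕ d ℤ.+ k) (n%ℕd<d i d) ⟩
  i %ℕ d
    ∎
  where
  open ≡-Reasoning
  regroup : ∀ r q k d → r ℤ.+ q ℤ.* d ℤ.+ k ℤ.* d ≡ r ℤ.+ (q ℤ.+ k) ℤ.* d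
  regroup = ℤ-Ring.solve-∀

-- Geometry of the king grid

infixl 6 _⊕_ _⊖_

_⊕_ : Pt → Pt → Pt
(x , y) ⊕ (x′ , y′) = (x ℤ.+ x′ , y ℤ.+ y′)

_⊖_ : Pt → Pt → Pt
(x , y) ⊖ (x′ , y′) = (x ℤ.- x′ , y ℤ.- y′)

origin : Pt
origin = (0ℤ , 0ℤ)

⊕-identityʳ : ∀ p → p ⊕ origin ≡ p
⊕-identityʳ (x , y) = cong₂ _,_ (ℤₚ.+-identityʳ x) (ℤₚ.+-identityʳ y)

⊕-assoc : ∀ a p q → a ⊕ p ⊕ q ≡ a ⊕ (p ⊕ q)
⊕-assoc (a , b) (x , y) (x′ , y′) = cong₂ _,_ (ℤₚ.+-assoc a x x′) (ℤₚ.+-assoc b y y′)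

⊕-⊖ : ∀ u v → u ⊕ (v ⊖ u) ≡ v
⊕-⊖ (x , y) (x′ , y′) = cong₂ _,_ (cancel x x′) (cancel y y′)
  where
  cancel : ∀ i j → i ℤ.+ (j ℤ.- i) ≡ j
  cancel = ℤ-Ring.solve-∀

dist : Pt → Pt → ℕ
dist (x , y) (x′ , y′) = ∣ x ℤ.- x′ ∣ ⊔ ∣ y ℤ.- y′ ∣

dist-sym : ∀ u v → dist u v ≡ dist v u
dist-sym (x , y) (x′ , y′) = cong₂ _⊔_ (ℤₚ.∣i-j∣≡∣j-i∣ x x′) (ℤₚ.∣i-j∣≡∣j-i∣ y y′)

∣i-k∣≤∣i-j∣+∣j-k∣ : ∀ i j k → ∣ i ℤ.- k ∣ ≤ ∣ i ℤ.- j ∣ + ∣ j ℤ.- k ∣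
∣i-k∣≤∣i-j∣+∣j-k∣ i j k = subst (λ m → ∣ m ∣ ≤ ∣ i ℤ.- j ∣ + ∣ j ℤ.- k ∣)
  (ℤₚ.+-minus-telescope i j k) (ℤₚ.∣i+j∣≤∣i∣+∣j∣ (i ℤ.- j) (j ℤ.- k))

dist-triangle : ∀ u v w → dist u w ≤ dist u v + dist v w
dist-triangle (x , y) (x′ , y′) (x″ , y″) = ℕₚ.⊔-lub
  (ℕₚ.≤-trans (∣i-k∣≤∣i-j∣+∣j-k∣ x x′ x″)
    (ℕₚ.+-mono-≤ (ℕₚ.m≤m⊔n dx dy) (ℕₚ.m≤m⊔n dx′ dy′)))
  (ℕₚ.≤-trans (∣i-k∣≤∣i-j∣+∣j-k∣ y y′ y″)
    (ℕₚ.+-mono-≤ (ℕₚ.m≤n⊔m dx dy) (ℕₚ.m≤n⊔m dx′ dy′)))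
  where
  dx dy dx′ dy′ : ℕ
  dx  = ∣ x ℤ.- x′ ∣
  dy  = ∣ y ℤ.- y′ ∣
  dx′ = ∣ x′ ℤ.- x″ ∣
  dy′ = ∣ y′ ℤ.- y″ ∣

dist-⊕ : ∀ a p q → dist (a ⊕ p) (a ⊕ q) ≡ dist p q
dist-⊕ (a , b) (x , y) (x′ , y′) = cong₂ (λ i j → ∣ i ∣ ⊔ ∣ j ∣) (cancel a x x′) (cancel b y y′)
  where
  cancel : ∀ a i j → a ℤ.+ i ℤ.- (a ℤ.+ j) ≡ i ℤ.- j
  cancel = ℤ-Ring.solve-∀

adj-⊕ : ∀ a p q → adj (a ⊕ p) (a ⊕ q) ≡ adj p q
adj-⊕ a p q = cong (_≡ᵇ 1) (dist-⊕ a p q)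

common-neighbour⇒dist≤2 : ∀ {u v w} → T (adj u w) → T (adj v w) → dist u v ≤ 2
common-neighbour⇒dist≤2 {u} {v} {w} uw vw = begin
  dist u v             ≤⟨ dist-triangle u w v ⟩
  dist u w + dist w v  ≡⟨ cong (_+_ (dist u w)) (dist-sym w v) ⟩
  dist u w + dist v w  ≡⟨ cong₂ _+_ (ℕₚ.≡ᵇ⇒≡ (dist u w) 1 uw) (ℕₚ.≡ᵇ⇒≡ (dist v w) 1 vw) ⟩
  2                    ∎
  where open ℕₚ.≤-Reasoning

∣i∣≤r⇒0≤i+r : ∀ {r} i → ∣ i ∣ ≤ r → 0ℤ ℤ.≤ i ℤ.+ + r
∣i∣≤r⇒0≤i+r (+ n)      _     = ℤ.+≤+ z≤n
∣i∣≤r⇒0≤i+r -[1+ n ] ∣i∣≤r = subst (0ℤ ℤ.≤_) (sym (ℤₚ.⊖-≥ ∣i∣≤r)) (ℤ.+≤+ z≤n)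

∣i∣≤r⇒i∈range : ∀ {r i} → ∣ i ∣ ≤ r → i ∈ range r
∣i∣≤r⇒i∈range {r} {i} ∣i∣≤r =
  subst (_∈ range r) shift-back (∈-map⁺ (λ k → + k ℤ.- + r) (∈-upTo⁺ k<width))
  where
  shift-back : + ∣ i ℤ.+ + r ∣ ℤ.- + r ≡ i
  shift-back = trans (cong (ℤ._- + r) (ℤₚ.0≤i⇒+∣i∣≡i (∣i∣≤r⇒0≤i+r i ∣i∣≤r))) (cancel i (+ r))
    where
    cancel : ∀ i r → i ℤ.+ r ℤ.- r ≡ i
    cancel = ℤ-Ring.solve-∀
  k<width : ∣ i ℤ.+ + r ∣ < 2 * r + 1
  k<width = begin-strict
    ∣ i ℤ.+ + r ∣  ≤⟨ ℤₚ.∣i+j∣≤∣i∣+∣j∣ i (+ r) ⟩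
    ∣ i ∣ + r      ≤⟨ ℕₚ.+-monoˡ-≤ r ∣i∣≤r ⟩
    r + r          ≡⟨ cong (_+_ r) (ℕₚ.+-identityʳ r) ⟨
    2 * r          <⟨ ℕₚ.m<m+n (2 * r) ℕ.z<s ⟩
    2 * r + 1      ∎
    where open ℕₚ.≤-Reasoning

dist≤⇒⊖∈ball : ∀ {r} u v → dist u v ≤ r → v ⊖ u ∈ ball r
dist≤⇒⊖∈ball {r} (x , y) (x′ , y′) d≤r =
  ∈-concat⁺′ (∈-map⁺ (x′ ℤ.- x ,_) (coordinate y y′ (ℕₚ.m≤n⊔m _ _)))
             (∈-map⁺ (λ a → map (a ,_) (range r)) (coordinate x x′ (ℕₚ.m≤m⊔n _ _)))
  where
  coordinate : ∀ i j → ∣ i ℤ.- j ∣ ≤ dist (x , y) (x′ , y′) → j ℤ.- i ∈ range r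
  coordinate i j ≤dist =
    ∣i∣≤r⇒i∈range (subst (_≤ r) (ℤₚ.∣i-j∣≡∣j-i∣ i j) (ℕₚ.≤-trans ≤dist d≤r))

-- box3 q and map (q ⊕_) (box3 origin) are definitionally equal.
box3-⊕ : ∀ a p → box3 (a ⊕ p) ≡ map (a ⊕_) (box3 p)
box3-⊕ a p = begin
  map (a ⊕ p ⊕_) (box3 origin)         ≡⟨ map-cong (⊕-assoc a p) (box3 origin) ⟩
  map (λ o → a ⊕ (p ⊕ o)) (box3 origin) ≡⟨ map-∘ {g = a ⊕_} {f = p ⊕_} (box3 origin) ⟩
  map (a ⊕_) (map (p ⊕_) (box3 origin)) ∎
  where open ≡-Reasoning

N-⊕ : ∀ a p → N (a ⊕ p) ≡ map (a ⊕_) (N p)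
N-⊕ a p = begin
  filterᵇ (adj (a ⊕ p)) (box3 (a ⊕ p))
    ≡⟨ cong (filterᵇ (adj (a ⊕ p))) (box3-⊕ a p) ⟩
  filterᵇ (adj (a ⊕ p)) (map (a ⊕_) (box3 p))
    ≡⟨ filterᵇ-map (adj (a ⊕ p)) (a ⊕_) (box3 p) ⟩
  map (a ⊕_) (filterᵇ (adj (a ⊕ p) ∘ (a ⊕_)) (box3 p))
    ≡⟨ cong (map (a ⊕_)) (filterᵇ-cong (adj-⊕ a p) (box3 p)) ⟩
  map (a ⊕_) (N p)
    ∎
  where open ≡-Reasoning

N[]-⊕ : ∀ S a p → N[ S ] (a ⊕ p) ≡ map (a ⊕_) (N[ S ∘ (a ⊕_) ] p)
N[]-⊕ S a p = trans (cong (filterᵇ S) (N-⊕ a p)) (filterᵇ-map S (a ⊕_) (N p))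

length-N[]-⊕ : ∀ S a p → length (N[ S ] (a ⊕ p)) ≡ length (N[ S ∘ (a ⊕_) ] p)
length-N[]-⊕ S a p = trans (cong length (N[]-⊕ S a p)) (length-map (a ⊕_) (N[ S ∘ (a ⊕_) ] p))

diffCount-⊕ : ∀ S a p q → diffCount S (a ⊕ p) (a ⊕ q) ≡ diffCount (S ∘ (a ⊕_)) p q
diffCount-⊕ S a p q = begin
  count (λ w → not (S w ∧ adj (a ⊕ q) w)) (N[ S ] (a ⊕ p))
    ≡⟨ cong (count _) (N[]-⊕ S a p) ⟩
  count (λ w → not (S w ∧ adj (a ⊕ q) w)) (map (a ⊕_) (N[ S ∘ (a ⊕_) ] p))
    ≡⟨ count-map (λ w → not (S w ∧ adj (a ⊕ q) w)) (a ⊕_) (N[ S ∘ (a ⊕_) ] p) ⟩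
  count (λ w → not (S (a ⊕ w) ∧ adj (a ⊕ q) (a ⊕ w))) (N[ S ∘ (a ⊕_) ] p)
    ≡⟨ count-cong (λ w → cong (λ b → not (S (a ⊕ w) ∧ b)) (adj-⊕ a q w)) (N[ S ∘ (a ⊕_) ] p) ⟩
  diffCount (S ∘ (a ⊕_)) p q
    ∎
  where open ≡-Reasoning

N[]-cong : ∀ {S T} → S ≗ T → ∀ v → N[ S ] v ≡ N[ T ] v
N[]-cong S≗T v = filterᵇ-cong S≗T (N v)

diffCount-cong : ∀ {S T} → S ≗ T → ∀ u v → diffCount S u v ≡ diffCount T u v
diffCount-cong {S} {T} S≗T u v = trans (cong (count _) (N[]-cong S≗T u))
  (count-cong (λ w → cong (λ b → not (b ∧ adj v w)) (S≗T w)) (N[ T ] u))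

diffCount-far : ∀ S u v → 2 < dist u v → diffCount S u v ≡ length (N[ S ] u)
diffCount-far S u v far =
  cong length (filter-all (λ w → T? (not (S w ∧ adj v w))) (All.map notShared adjacent))
  where
  adjacent : All (T ∘ adj u) (N[ S ] u)
  adjacent = filter⁺ (λ w → T? (S w)) (all-filter (λ w → T? (adj u w)) (box3 u))

  notShared : ∀ {w} → T (adj u w) → T (not (S w ∧ adj v w))
  notShared {w} uw with S w | adj v w in vw
  ... | false | _     = tt
  ... | true  | false = tt
  ... | true  | true  =
    ⊥-elim (ℕₚ.<⇒≱ far (common-neighbour⇒dist≤2 {u} {v} {w} uw (subst T (sym vw) tt)))

-- Checking the DET:OLD conditions locally

Separated : Subset → Pt → Pt → Set
Separated S u v = 2 ≤ diffCount S u v ⊎ 2 ≤ diffCount S v u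

LocallyDetOLD : Subset → Set
LocallyDetOLD S = 2 ≤ length (N[ S ] origin) × All (λ d → d ≡ origin ⊎ Separated S origin d) (ball 2)

locallyDetOLD? : ∀ S → Dec (LocallyDetOLD S)
locallyDetOLD? S = (2 ≤? _) ×-dec All.all? (λ d → d ≟ origin ⊎-dec ((2 ≤? _) ⊎-dec (2 ≤? _))) (ball 2)
  where
  _≟_ : DecidableEquality Pt
  _≟_ = ≡-dec ℤ._≟_ ℤ._≟_

Separated-cong : ∀ {S T} → S ≗ T → ∀ u v → Separated S u v → Separated T u v
Separated-cong S≗T u v =
  Sum.map (subst (2 ≤_) (diffCount-cong S≗T u v)) (subst (2 ≤_) (diffCount-cong S≗T v u))

LocallyDetOLD-cong : ∀ {S T} → S ≗ T → LocallyDetOLD S → LocallyDetOLD T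
LocallyDetOLD-cong S≗T = Product.map (subst (2 ≤_) (cong length (N[]-cong S≗T origin)))
                                      (All.map (λ {d} → Sum.map₂ (Separated-cong S≗T origin d)))

Separated-⊕ : ∀ S a {p q} → Separated (S ∘ (a ⊕_)) p q → Separated S (a ⊕ p) (a ⊕ q)
Separated-⊕ S a {p} {q} =
  Sum.map (subst (2 ≤_) (sym (diffCount-⊕ S a p q))) (subst (2 ≤_) (sym (diffCount-⊕ S a q p)))

detOLD-fromLocal : ∀ S → (∀ u → LocallyDetOLD (S ∘ (u ⊕_))) → IsDetOLD S
detOLD-fromLocal S local = dominating , separating
  where
  dominating : ∀ v → 2 ≤ length (N[ S ] v)
  dominating v = subst (λ w → 2 ≤ length (N[ S ] w)) (⊕-identityʳ v)
                   (subst (2 ≤_) (sym (length-N[]-⊕ S v origin)) (proj₁ (local v)))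

  separating : ∀ u v → ¬ u ≡ v → Separated S u v
  separating u v u≢v with 2 <? dist u v
  ... | yes far = inj₁ (subst (2 ≤_) (sym (diffCount-far S u v far)) (dominating u))
  ... | no ¬far with All.lookup (proj₂ (local u)) (dist≤⇒⊖∈ball u v (ℕₚ.≮⇒≥ ¬far))
  ...   | inj₁ v⊖u≡0 = ⊥-elim (u≢v (begin
    u                ≡⟨ sym (⊕-identityʳ u) ⟩
    u ⊕ origin       ≡⟨ cong (u ⊕_) v⊖u≡0 ⟨
    u ⊕ (v ⊖ u)      ≡⟨ ⊕-⊖ u v ⟩
    v                ∎))
    where open ≡-Reasoning
  ...   | inj₂ sep = subst₂ (Separated S) (⊕-identityʳ u) (⊕-⊖ u v) (Separated-⊕ S u sep)

-- Density from row counts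

width : ℕ → ℕ
width r = 2 * r + 1

r≤width : ∀ r → r ≤ width r
r≤width r = ℕₚ.≤-trans (ℕₚ.m≤m+n r (r + 0)) (ℕₚ.m≤m+n (2 * r) 1)

length-range : ∀ r → length (range r) ≡ width r
length-range r = trans (length-map _ (upTo (width r))) (length-upTo (width r))

row : ℕ → ℤ → List Pt
row r x = map (x ,_) (range r)

absorb-lower-order : ∀ {a b c K L C} → b * K ≤ L → c ≤ a → a * C ≤ L * (b * (L + c)) →
                     a * K * C ≤ (b * K + a) * (L * L)
absorb-lower-order {a} {b} {c} {K} {L} {C} bK≤L c≤a aC≤ = begin
  a * K * C                          ≡⟨ swap a K C ⟩
  K * (a * C)                        ≤⟨ ℕₚ.*-monoʳ-≤ K aC≤ ⟩
  K * (L * (b * (L + c)))            ≡⟨ expand b c K L ⟩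
  b * K * (L * L) + b * K * (c * L)  ≤⟨ ℕₚ.+-monoʳ-≤ (b * K * (L * L)) (ℕₚ.*-monoˡ-≤ _ bK≤L) ⟩
  b * K * (L * L) + L * (c * L)      ≡⟨ cong (_+_ (b * K * (L * L))) (rotate c L) ⟩
  b * K * (L * L) + c * (L * L)      ≤⟨ ℕₚ.+-monoʳ-≤ (b * K * (L * L)) (ℕₚ.*-monoˡ-≤ _ c≤a) ⟩
  b * K * (L * L) + a * (L * L)      ≡⟨ ℕₚ.*-distribʳ-+ (L * L) (b * K) a ⟨
  (b * K + a) * (L * L)              ∎
  where
  open ℕₚ.≤-Reasoning
  swap : ∀ a K C → a * K * C ≡ K * (a * C)
  swap = ℕ-Ring.solve-∀
  expand : ∀ b c K L → K * (L * (b * (L + c))) ≡ b * K * (L * L) + b * K * (c * L)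
  expand = ℕ-Ring.solve-∀
  rotate : ∀ c L → L * (c * L) ≡ c * (L * L)
  rotate = ℕ-Ring.solve-∀

densityAtMost-fromRows : ∀ {S p q c} → c ≤ q →
                         (∀ r x → q * count S (row r x) ≤ p * (width r + c)) →
                         DensityAtMost S p q
densityAtMost-fromRows {S} {p} {q} {c} c≤q rowBound k = p * suc k , λ r pK≤r →
  absorb-lower-order {b = p} (ℕₚ.≤-trans pK≤r (r≤width r)) c≤q (ball-bound r)
  where
  ball-bound : ∀ r → q * countIn S r ≤ width r * (p * (width r + c))
  ball-bound r = subst (λ n → q * countIn S r ≤ n * (p * (width r + c))) (length-range r)
                   (count-concatMap-≤ {k = q} S (row r) (range r) (rowBound r))

residues : List ℕ
residues = 0 ∷ 2 ∷ 5 ∷ 7 ∷ 9 ∷ 12 ∷ 14 ∷ 15 ∷ 19 ∷ 20 ∷ 24 ∷ 25 ∷ 29 ∷ []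

inResidues : ℤ → Bool
inResidues i = does (i %ℕ 30 ∈? residues)

phase : Pt → ℤ
phase (x , y) = y ℤ.+ + 19 ℤ.* x

residue : Pt → ℕ
residue p = phase p %ℕ 30

periodicSet : Subset
periodicSet p = inResidues (phase p)

inResidues-periodic : ∀ i k → inResidues (i ℤ.+ k ℤ.* + 30) ≡ inResidues i
inResidues-periodic i k = cong (λ r → does (r ∈? residues)) (%ℕ-periodic i k)

periodicSet-by-residue : ∀ p₀ p t → phase p ≡ phase p₀ ℤ.+ t →
                         periodicSet p ≡ inResidues (+ residue p₀ ℤ.+ t)
periodicSet-by-residue p₀ p t eq = trans (cong inResidues (begin
  phase p                                ≡⟨ eq ⟩
  phase p₀ ℤ.+ t                         ≡⟨ cong (ℤ._+ t) (a≡a%ℕn+[a/ℕn]*n (phase p₀) 30) ⟩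
  + residue p₀ ℤ.+ q ℤ.* + 30 ℤ.+ t      ≡⟨ regroup (+ residue p₀) q t ⟩
  + residue p₀ ℤ.+ t ℤ.+ q ℤ.* + 30      ∎))
  (inResidues-periodic (+ residue p₀ ℤ.+ t) q)
  where
  open ≡-Reasoning
  q : ℤ
  q = phase p₀ /ℕ 30
  regroup : ∀ r q t → r ℤ.+ q ℤ.* + 30 ℤ.+ t ≡ r ℤ.+ t ℤ.+ q ℤ.* + 30
  regroup = ℤ-Ring.solve-∀

phase-⊕ : ∀ u w → phase (u ⊕ w) ≡ phase u ℤ.+ phase w
phase-⊕ (x , y) (a , b) = regroup x y a b
  where
  regroup : ∀ x y a b → y ℤ.+ b ℤ.+ + 19 ℤ.* (x ℤ.+ a) ≡ y ℤ.+ + 19 ℤ.* x ℤ.+ (b ℤ.+ + 19 ℤ.* a)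
  regroup = ℤ-Ring.solve-∀

localView : ℕ → Subset
localView ρ w = inResidues (+ ρ ℤ.+ phase w)

periodicSet-⊕ : ∀ u → periodicSet ∘ (u ⊕_) ≗ localView (residue u)
periodicSet-⊕ u w = periodicSet-by-residue u (u ⊕ w) (phase w) (phase-⊕ u w)

localView-detOLD : ∀ {ρ} → ρ < 30 → LocallyDetOLD (localView ρ)
localView-detOLD = from-yes (ℕₚ.allUpTo? (λ ρ → locallyDetOLD? (localView ρ)) 30)

periodicSet-isDetOLD : IsDetOLD periodicSet
periodicSet-isDetOLD = detOLD-fromLocal periodicSet λ u →
  LocallyDetOLD-cong (λ w → sym (periodicSet-⊕ u w)) (localView-detOLD (n%ℕd<d (phase u) 30))

window : ℕ → ℕ → Bool
window ρ k = inResidues (+ ρ ℤ.+ + k)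

window-periodic : ∀ ρ k → window ρ (30 + k) ≡ window ρ k
window-periodic ρ k =
  trans (cong (λ n → inResidues (+ n)) (regroup ρ k)) (inResidues-periodic (+ (ρ + k)) (+ 1))
  where
  regroup : ∀ ρ k → ρ + (30 + k) ≡ ρ + k + 30
  regroup = ℕ-Ring.solve-∀

window-counts : ∀ {ρ} → ρ < 30 →
                countBelow (window ρ) 30 ≡ 13 ×
                (∀ {L} → L < 30 → 30 * countBelow (window ρ) L ≤ 13 * (L + 29))
window-counts = from-yes (ℕₚ.allUpTo? (λ ρ →
  (countBelow (window ρ) 30 ℕ.≟ 13) ×-dec
  ℕₚ.allUpTo? (λ L → 30 * countBelow (window ρ) L ≤? 13 * (L + 29)) 30) 30)

row-count : ∀ r x → count periodicSet (row r x) ≡ countBelow (window (residue (x , ℤ.- + r))) (width r)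
row-count r x = begin
  count periodicSet (map (x ,_) (range r))
    ≡⟨ count-map periodicSet (x ,_) (range r) ⟩
  count (periodicSet ∘ (x ,_)) (map column (upTo (width r)))
    ≡⟨ count-map (periodicSet ∘ (x ,_)) column (upTo (width r)) ⟩
  count (periodicSet ∘ (x ,_) ∘ column) (upTo (width r))
    ≡⟨ count-applyUpTo (periodicSet ∘ (x ,_) ∘ column) (λ i → i) (width r) ⟩
  countBelow (periodicSet ∘ (x ,_) ∘ column) (width r)
    ≡⟨ countBelow-cong (λ i → periodicSet-by-residue (x , ℤ.- + r) (x , column i) (+ i) (shift i)) (width r) ⟩
  countBelow (window (residue (x , ℤ.- + r))) (width r)
    ∎
  where
  open ≡-Reasoning
  column : ℕ → ℤ
  column i = + i ℤ.- + r
  shift : ∀ i → phase (x , column i) ≡ phase (x , ℤ.- + r) ℤ.+ + i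
  shift i = regroup (+ i) (+ r) x
    where
    regroup : ∀ i r x → i ℤ.- r ℤ.+ + 19 ℤ.* x ≡ ℤ.- r ℤ.+ + 19 ℤ.* x ℤ.+ i
    regroup = ℤ-Ring.solve-∀

periodicSet-rowBound : ∀ r x → 30 * count periodicSet (row r x) ≤ 13 * (width r + 29)
periodicSet-rowBound r x = subst (λ n → 30 * n ≤ 13 * (width r + 29)) (sym (row-count r x))
  (countBelow-periodic-≤ (window ρ) (window-periodic ρ)
    (proj₁ (window-counts ρ<30)) (proj₂ (window-counts ρ<30)) (width r))
  where
  ρ : ℕ
  ρ = residue (x , ℤ.- + r)
  ρ<30 : ρ < 30
  ρ<30 = n%ℕd<d (phase (x , ℤ.- + r)) 30

theorem7 : Σ[ S ∈ Subset ] (IsDetOLD S × DensityAtMost S 13 30)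
theorem7 = periodicSet , periodicSet-isDetOLD , density
  where
  density : DensityAtMost periodicSet 13 30
  density = densityAtMost-fromRows {p = 13} {c = 29} (ℕₚ.n≤1+n 29) periodicSet-rowBound
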